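{- Let $r, n$ be integers with $3 < r < n$ satisfying $$\binom{n-r+3}{2} \ge n \ge \begin{cases} 2(n-r)+4 & \text{if } n-r \text{ is odd},\\ 2(n-r)+3 & \text{if } n-r \text{ is even}.\end{cases}$$ Then there exists a primitive uniquely $K_r^{(3)}$-saturated $3$-uniform hypergraph on $n$ vertices.
   Context: $K_r^{(k)}$ denotes the complete $k$-uniform hypergraph on $r$ vertices. A $k$-uniform hypergraph $H$ is uniquely $K_r^{(k)}$-saturated if $H$ contains no copy of $K_r^{(k)}$ (i.e., no $r$-set of vertices all of whose $k$-subsets are edges), and for every $k$-subset $S$ of $V(H)$ that is not an edge of $H$, the hypergraph $H+S$ contains exactly one copy of $K_r^{(k)}$. A vertex $v$ is dominating in $H$ if every $k$-subset of $V(H)$ containing $v$ is an edge of $H$. $H$ is primitive uniquely $K_r^{(k)}$-saturated if it is uniquely $K_r^{(k)}$-saturated and has no dominating vertex. -}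

module Defs where

open import Data.Nat using (ℕ)
open import Data.Bool using (Bool; true; false)
open import Data.Fin using (Fin)
open import Data.Fin.Subset using (Subset; _∈_; _⊆_; ∣_∣)
open import Data.Product using (Σ; _×_; ∃-syntax)
open import Data.Sum using (_⊎_)
open import Relation.Binary.PropositionalEquality using (_≡_)
open import Relation.Nullary using (¬_)

-- A k-uniform hypergraph on vertex set Fin n: a Boolean marking of subsets;
-- only subsets of size k matter (the edges are the marked k-subsets).
record Hypergraph (k n : ℕ) : Set where
  field
    mark : Subset n → Bool

open Hypergraph public

IsEdge : ∀ {k n} → Hypergraph k n → Subset n → Set
IsEdge {k} H S = (∣ S ∣ ≡ k) × (mark H S ≡ true)

IsNonEdge : ∀ {k n} → Hypergraph k n → Subset n → Set
IsNonEdge {k} H S = (∣ S ∣ ≡ k) × (mark H S ≡ false)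

IsCliqueOf : (k r : ℕ) {n : ℕ} → (Subset n → Set) → Subset n → Set
IsCliqueOf k r E R = (∣ R ∣ ≡ r) × (∀ S → S ⊆ R → ∣ S ∣ ≡ k → E S)

PlusEdge : ∀ {k n} → Hypergraph k n → Subset n → Subset n → Set
PlusEdge H S T = IsEdge H T ⊎ (T ≡ S)

KFree : ∀ {k n} (r : ℕ) → Hypergraph k n → Set
KFree {k} r H = ∀ R → ¬ IsCliqueOf k r (IsEdge H) R

ExactlyOneClique : (k r : ℕ) {n : ℕ} → (Subset n → Set) → Set
ExactlyOneClique k r E =
  ∃[ R ] (IsCliqueOf k r E R × (∀ R' → IsCliqueOf k r E R' → R' ≡ R))

UniquelySaturated : ∀ {k n} (r : ℕ) → Hypergraph k n → Set
UniquelySaturated {k} r H =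
  KFree r H × (∀ S → IsNonEdge H S → ExactlyOneClique k r (PlusEdge H S))

Dominating : ∀ {k n} → Hypergraph k n → Fin n → Set
Dominating {k} H v = ∀ S → ∣ S ∣ ≡ k → v ∈ S → IsEdge H S

PrimitiveUniquelySaturated : ∀ {k n} (r : ℕ) → Hypergraph k n → Set
PrimitiveUniquelySaturated r H =
  UniquelySaturated r H × (∀ v → ¬ Dominating H v)

module Submission where

-- Put m = n − r and K = r − 2, and split the vertices into a core {0, …, m + 1} of size
-- p = m + 2 and K extra vertices.  Fix a proper edge colouring of the complete graph on the
-- core using all K colours; the non-edges of H are the triangles {c, d, p + colour c d}
-- (TriangleHypergraph).  A (K + 2)-set leaves out only m vertices, and a pigeonhole count on the
-- injective map d ↦ p + colour c d (crowded) puts a triangle inside it.  Hence H is K_{K+2}-free,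
-- adding the triangle of {a, b} creates exactly one clique, namely all vertices except
-- core ∖ {a, b}, and no vertex is dominating since every vertex lies on a triangle.
--
-- The colourings: (c + d) mod p on the core for odd m, the 1-factorisation of K_p for even m;
-- each shows every colour on the last pairs of a fixed enumeration of pairs (TailRainbow), so
-- giving the first pairs new colours (Recolouring) reaches every K between m + 1 + (m mod 2) and
-- C(p, 2).  This range is exactly the hypothesis of corollary2.

open import Defs
open import Data.Nat using (ℕ; _+_; _*_; _∸_; _<_; _≤_; _%_)
open import Data.Nat.Combinatorics using (_C_)
open import Data.Product using (_×_; ∃-syntax)
open import Relation.Binary.PropositionalEquality using (_≡_)

open import Data.Nat
open import Data.Nat.Properties
open import Data.Nat.DivMod using ([m+kn]%n≡m%n)
open import Data.Nat.Combinatorics using (nC1≡n; nCk+nC[k+1]≡[n+1]C[k+1])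
open import Data.Nat.Tactic.RingSolver using (solve-∀)
open import Data.Bool using (Bool; true; false; _∧_; _∨_; not; T; if_then_else_)
open import Data.Bool.Properties
  using (∧-identityʳ; ∨-zeroʳ; ∧-distribˡ-∨; ∧-comm; ¬-not; not-involutive; T-≡)
  renaming (_≟_ to _≟ᵇ_)
open import Data.Fin using (zero; suc; toℕ; fromℕ<)
open import Data.Fin.Properties using (toℕ<n; toℕ-fromℕ<)
open import Data.Fin.Subset using (Subset; _∈_; _⊆_; ∣_∣)
open import Data.Vec using ([]; _∷_; tabulate; here; there)
open import Data.Vec.Properties using (≡-dec)
open import Data.Product using (Σ; _,_; proj₁; proj₂; ∃; ∃₂)
open import Data.Sum using (_⊎_; inj₁; inj₂)
open import Function using (_∘_)
open import Function.Bundles using (Equivalence)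
open import Relation.Nullary using (¬_; Dec; yes; no; does; contradiction; ¬?)
open import Relation.Nullary.Decidable using (_×-dec_; dec-true)
open import Relation.Binary.PropositionalEquality
open import Relation.Binary.Definitions using (tri<; tri≈; tri>)
import Algebra.Properties.CommutativeSemigroup as CommSemigroupProperties
open CommSemigroupProperties +-commutativeSemigroup using (interchange)

T⇒≡true : ∀ {b} → T b → b ≡ true
T⇒≡true = Equivalence.to T-≡

≡true⇒T : ∀ {b} → b ≡ true → T b
≡true⇒T = Equivalence.from T-≡

≡ᵇ-true : ∀ {m n} → m ≡ n → (m ≡ᵇ n) ≡ true
≡ᵇ-true {m} refl = T⇒≡true (≡⇒≡ᵇ m m refl)

≡ᵇ-sound : ∀ {m n} → (m ≡ᵇ n) ≡ true → m ≡ n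
≡ᵇ-sound {m} {n} e = ≡ᵇ⇒≡ m n (≡true⇒T e)

≡ᵇ-false : ∀ {m n} → m ≢ n → (m ≡ᵇ n) ≡ false
≡ᵇ-false {m} {n} m≢n with m ≡ᵇ n in e
... | false = refl
... | true  = contradiction (≡ᵇ-sound e) m≢n

≡ᵇ-false-sound : ∀ {m n} → (m ≡ᵇ n) ≡ false → m ≢ n
≡ᵇ-false-sound {m} e refl with trans (sym e) (≡ᵇ-true {m} refl)
... | ()

<ᵇ-true : ∀ {m n} → m < n → (m <ᵇ n) ≡ true
<ᵇ-true m<n = T⇒≡true (<⇒<ᵇ m<n)

<ᵇ-sound : ∀ {m n} → (m <ᵇ n) ≡ true → m < n
<ᵇ-sound {m} {n} e = <ᵇ⇒< m n (≡true⇒T e)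

<ᵇ-false : ∀ {m n} → n ≤ m → (m <ᵇ n) ≡ false
<ᵇ-false {m} {n} n≤m with m <ᵇ n in e
... | false = refl
... | true  = contradiction n≤m (<⇒≱ (<ᵇ-sound e))

∧-true : ∀ {a b} → (a ∧ b) ≡ true → a ≡ true × b ≡ true
∧-true {true} {true} _ = refl , refl

∨-true : ∀ {a b} → (a ∨ b) ≡ true → a ≡ true ⊎ b ≡ true
∨-true {true}  _ = inj₁ refl
∨-true {false} e = inj₂ e

∨-introˡ : ∀ {a} b → a ≡ true → (a ∨ b) ≡ true
∨-introˡ b refl = refl

∨-introʳ : ∀ a {b} → b ≡ true → (a ∨ b) ≡ true
∨-introʳ a refl = ∨-zeroʳ a

not-false : ∀ {a} → not a ≡ false → a ≡ true
not-false {true} _ = refl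

not-true : ∀ {a} → not a ≡ true → a ≡ false
not-true {false} _ = refl

indicator : Bool → ℕ
indicator true  = 1
indicator false = 0

count : ℕ → (ℕ → Bool) → ℕ
count zero    P = 0
count (suc n) P = indicator (P 0) + count n (P ∘ suc)

count-cong : ∀ n {P Q : ℕ → Bool} → (∀ x → x < n → P x ≡ Q x) → count n P ≡ count n Q
count-cong zero    P≗Q = refl
count-cong (suc n) P≗Q =
  cong₂ _+_ (cong indicator (P≗Q 0 z<s)) (count-cong n (λ x x<n → P≗Q (suc x) (s<s x<n)))

count-false : ∀ n → count n (λ _ → false) ≡ 0
count-false zero    = refl
count-false (suc n) = count-false n

indicator-mono : ∀ {a b} → (a ≡ true → b ≡ true) → indicator a ≤ indicator b
indicator-mono {false} a⇒b = z≤n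
indicator-mono {true}  a⇒b rewrite a⇒b refl = ≤-refl

indicator-reflect : ∀ {a b} → indicator b ≤ indicator a → b ≡ true → a ≡ true
indicator-reflect {true}  _  _    = refl
indicator-reflect {false} () refl

count-mono : ∀ n {P Q : ℕ → Bool} → (∀ x → x < n → P x ≡ true → Q x ≡ true) →
             count n P ≤ count n Q
count-mono zero    P⊆Q = z≤n
count-mono (suc n) P⊆Q =
  +-mono-≤ (indicator-mono (P⊆Q 0 z<s)) (count-mono n (λ x x<n → P⊆Q (suc x) (s<s x<n)))

count-split : ∀ n (P Q : ℕ → Bool) →
              count n P ≡ count n (λ x → P x ∧ Q x) + count n (λ x → P x ∧ not (Q x))
count-split zero    P Q = refl
count-split (suc n) P Q = begin
    indicator (P 0) + count n (P ∘ suc)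
  ≡⟨ cong₂ _+_ (split (P 0) (Q 0)) (count-split n (P ∘ suc) (Q ∘ suc)) ⟩
    (indicator (P 0 ∧ Q 0) + indicator (P 0 ∧ not (Q 0))) + (both + onlyP)
  ≡⟨ interchange (indicator (P 0 ∧ Q 0)) _ both onlyP ⟩
    (indicator (P 0 ∧ Q 0) + both) + (indicator (P 0 ∧ not (Q 0)) + onlyP) ∎
  where
  open ≡-Reasoning
  both onlyP : ℕ
  both  = count n (λ x → P (suc x) ∧ Q (suc x))
  onlyP = count n (λ x → P (suc x) ∧ not (Q (suc x)))
  split : ∀ a b → indicator a ≡ indicator (a ∧ b) + indicator (a ∧ not b)
  split false b     = refl
  split true  false = refl
  split true  true  = refl

count-complement : ∀ n (P : ℕ → Bool) → count n P + count n (not ∘ P) ≡ n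
count-complement zero    P = refl
count-complement (suc n) P = begin
    (indicator (P 0) + count n (P ∘ suc)) + (indicator (not (P 0)) + count n (not ∘ P ∘ suc))
  ≡⟨ interchange (indicator (P 0)) (count n (P ∘ suc)) (indicator (not (P 0))) _ ⟩
    (indicator (P 0) + indicator (not (P 0))) + (count n (P ∘ suc) + count n (not ∘ P ∘ suc))
  ≡⟨ cong₂ _+_ (complement (P 0)) (count-complement n (P ∘ suc)) ⟩
    suc n ∎
  where
  open ≡-Reasoning
  complement : ∀ a → indicator a + indicator (not a) ≡ 1
  complement false = refl
  complement true  = refl

count-disjoint : ∀ n (P Q : ℕ → Bool) → (∀ x → x < n → (P x ∧ Q x) ≡ false) →
                 count n (λ x → P x ∨ Q x) ≡ count n P + count n Q
count-disjoint zero    P Q disj = refl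
count-disjoint (suc n) P Q disj = begin
    indicator (P 0 ∨ Q 0) + count n (λ x → P (suc x) ∨ Q (suc x))
  ≡⟨ cong₂ _+_ (union (P 0) (Q 0) (disj 0 z<s))
               (count-disjoint n (P ∘ suc) (Q ∘ suc) (λ x x<n → disj (suc x) (s<s x<n))) ⟩
    (indicator (P 0) + indicator (Q 0)) + (count n (P ∘ suc) + count n (Q ∘ suc))
  ≡⟨ interchange (indicator (P 0)) (indicator (Q 0)) (count n (P ∘ suc)) _ ⟩
    (indicator (P 0) + count n (P ∘ suc)) + (indicator (Q 0) + count n (Q ∘ suc)) ∎
  where
  open ≡-Reasoning
  union : ∀ a b → (a ∧ b) ≡ false → indicator (a ∨ b) ≡ indicator a + indicator b
  union false b     _ = refl
  union true  false _ = refl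

count-single : ∀ {n y} → y < n → count n (λ x → x ≡ᵇ y) ≡ 1
count-single {suc n} {zero}  _     = cong suc (count-false n)
count-single {suc n} {suc y} y<1+n = count-single (s<s⁻¹ y<1+n)

count-below : ∀ {n p} → p ≤ n → count n (λ x → x <ᵇ p) ≡ p
count-below {n}     {zero}  _     = count-false n
count-below {suc n} {suc p} p<1+n = cong suc (count-below (s≤s⁻¹ p<1+n))

count-remove : ∀ {n} (P : ℕ → Bool) {y} → y < n → P y ≡ true →
               count n P ≡ suc (count n (λ x → P x ∧ not (x ≡ᵇ y)))
count-remove {suc n} P {zero} _ P0 rewrite P0 =
  cong suc (count-cong n (λ x _ → sym (∧-identityʳ (P (suc x)))))
count-remove {suc n} P {suc y} y<1+n Py rewrite ∧-identityʳ (P 0) =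
  trans (cong (indicator (P 0) +_) (count-remove (P ∘ suc) (s<s⁻¹ y<1+n) Py))
        (+-suc (indicator (P 0)) _)

count-equal-subset : ∀ n {P Q : ℕ → Bool} → (∀ x → x < n → P x ≡ true → Q x ≡ true) →
                     count n Q ≤ count n P → ∀ x → x < n → Q x ≡ true → P x ≡ true
count-equal-subset (suc n) {P} {Q} P⊆Q Q≤P x x<n Qx = at x x<n Qx
  where
  P0≤Q0 : indicator (P 0) ≤ indicator (Q 0)
  P0≤Q0 = indicator-mono (P⊆Q 0 z<s)
  P′⊆Q′ : ∀ x → x < n → P (suc x) ≡ true → Q (suc x) ≡ true
  P′⊆Q′ x x<n = P⊆Q (suc x) (s<s x<n)
  P′≤Q′ : count n (P ∘ suc) ≤ count n (Q ∘ suc)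
  P′≤Q′ = count-mono n P′⊆Q′
  at : ∀ x → x < suc n → Q x ≡ true → P x ≡ true
  at zero    _     Q0  = indicator-reflect
    (+-cancelʳ-≤ _ _ _ (≤-trans Q≤P (+-monoʳ-≤ (indicator (P 0)) P′≤Q′))) Q0
  at (suc x) x<1+n Qx′ = count-equal-subset n P′⊆Q′
    (+-cancelˡ-≤ _ _ _ (≤-trans Q≤P (+-monoˡ-≤ (count n (P ∘ suc)) P0≤Q0))) x (s<s⁻¹ x<1+n) Qx′

count-injection : ∀ n m {P Q : ℕ → Bool} (f : ℕ → ℕ) →
  (∀ x → x < n → P x ≡ true → f x < m × Q (f x) ≡ true) →
  (∀ x y → x < n → y < n → P x ≡ true → P y ≡ true → f x ≡ f y → x ≡ y) →
  count n P ≤ count m Q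
count-injection zero    m f maps inj = z≤n
count-injection (suc n) m {P} {Q} f maps inj with P 0 in P0
... | false = count-injection n m (f ∘ suc) (λ x x<n → maps (suc x) (s<s x<n))
                (λ x y x<n y<n Px Py e → suc-injective (inj (suc x) (suc y) (s<s x<n) (s<s y<n) Px Py e))
... | true  = subst (suc (count n (P ∘ suc)) ≤_) (sym (count-remove Q f0<m Qf0)) (s≤s rest)
  where
  f0<m : f 0 < m
  f0<m = proj₁ (maps 0 z<s P0)
  Qf0 : Q (f 0) ≡ true
  Qf0  = proj₂ (maps 0 z<s P0)
  Q′ : ℕ → Bool
  Q′ z = Q z ∧ not (z ≡ᵇ f 0)
  maps′ : ∀ x → x < n → P (suc x) ≡ true → f (suc x) < m × Q′ (f (suc x)) ≡ true
  maps′ x x<n Px with maps (suc x) (s<s x<n) Px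
  ... | fx<m , Qfx rewrite Qfx | ≡ᵇ-false (λ e → 1+n≢0 (inj (suc x) 0 (s<s x<n) z<s Px P0 e)) =
    fx<m , refl
  rest : count n (P ∘ suc) ≤ count m Q′
  rest = count-injection n m (f ∘ suc) maps′
           (λ x y x<n y<n Px Py e → suc-injective (inj (suc x) (suc y) (s<s x<n) (s<s y<n) Px Py e))

count-three : ∀ {n a b e} → a < n → b < n → e < n → a ≢ b → a ≢ e → b ≢ e →
              count n (λ x → (x ≡ᵇ a) ∨ ((x ≡ᵇ b) ∨ (x ≡ᵇ e))) ≡ 3
count-three {n} {a} {b} {e} a<n b<n e<n a≢b a≢e b≢e = begin
    count n (λ x → (x ≡ᵇ a) ∨ ((x ≡ᵇ b) ∨ (x ≡ᵇ e)))
  ≡⟨ count-disjoint n _ _ (λ x _ → trans (∧-distribˡ-∨ (x ≡ᵇ a) _ _)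
                                         (cong₂ _∨_ (apart x a≢b) (apart x a≢e))) ⟩
    count n (λ x → x ≡ᵇ a) + count n (λ x → (x ≡ᵇ b) ∨ (x ≡ᵇ e))
  ≡⟨ cong (count n (λ x → x ≡ᵇ a) +_) (count-disjoint n _ _ (λ x _ → apart x b≢e)) ⟩
    count n (λ x → x ≡ᵇ a) + (count n (λ x → x ≡ᵇ b) + count n (λ x → x ≡ᵇ e))
  ≡⟨ cong₂ _+_ (count-single a<n) (cong₂ _+_ (count-single b<n) (count-single e<n)) ⟩
    3 ∎
  where
  open ≡-Reasoning
  apart : ∀ {u v} x → u ≢ v → ((x ≡ᵇ u) ∧ (x ≡ᵇ v)) ≡ false
  apart {u} {v} x u≢v with x ≡ᵇ u in x≡u
  ... | false = refl
  ... | true  = ≡ᵇ-false (λ x≡v → u≢v (trans (sym (≡ᵇ-sound {x} x≡u)) x≡v))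

-- A subset of Fin n as a Boolean predicate on ℕ (false from n on), and back; ∣_∣, equality,
-- ∈ and ⊆ are all read off from this predicate.
member : ∀ {n} → Subset n → ℕ → Bool
member []      _       = false
member (b ∷ S) zero    = b
member (b ∷ S) (suc x) = member S x

∣∣≡count : ∀ {n} (S : Subset n) → ∣ S ∣ ≡ count n (member S)
∣∣≡count []          = refl
∣∣≡count (true  ∷ S) = cong suc (∣∣≡count S)
∣∣≡count (false ∷ S) = ∣∣≡count S

fromPred : ∀ {n} → (ℕ → Bool) → Subset n
fromPred P = tabulate (λ v → P (toℕ v))

member-fromPred : ∀ {n} (P : ℕ → Bool) {x} → x < n → member (fromPred {n} P) x ≡ P x
member-fromPred {suc n} P {zero}  _     = refl
member-fromPred {suc n} P {suc x} x<1+n = member-fromPred (λ y → P (suc y)) (s<s⁻¹ x<1+n)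

member-ext : ∀ {n} (S T : Subset n) → (∀ x → x < n → member S x ≡ member T x) → S ≡ T
member-ext []      []      _ = refl
member-ext (a ∷ S) (b ∷ T) h = cong₂ _∷_ (h 0 z<s) (member-ext S T (λ x x<n → h (suc x) (s<s x<n)))

∈⇒member : ∀ {n} {S : Subset n} {v} → v ∈ S → member S (toℕ v) ≡ true
∈⇒member here        = refl
∈⇒member (there v∈S) = ∈⇒member v∈S

member⇒∈ : ∀ {n} (S : Subset n) v → member S (toℕ v) ≡ true → v ∈ S
member⇒∈ (true ∷ S) zero    _ = here
member⇒∈ (b    ∷ S) (suc v) e = there (member⇒∈ S v e)

⊆⇒member : ∀ {n} {S T : Subset n} → S ⊆ T → ∀ x → x < n → member S x ≡ true → member T x ≡ true
⊆⇒member {S = S} {T} S⊆T x x<n Sx =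
  subst (λ y → member T y ≡ true) (toℕ-fromℕ< x<n)
    (∈⇒member (S⊆T (member⇒∈ S (fromℕ< x<n)
      (subst (λ y → member S y ≡ true) (sym (toℕ-fromℕ< x<n)) Sx))))

member⇒⊆ : ∀ {n} {S T : Subset n} → (∀ x → x < n → member S x ≡ true → member T x ≡ true) → S ⊆ T
member⇒⊆ {T = T} S⊆T {v} v∈S = member⇒∈ T v (S⊆T (toℕ v) (toℕ<n v) (∈⇒member v∈S))

record EdgeColouring (p K : ℕ) : Set where
  field
    colour        : ℕ → ℕ → ℕ
    colour-sym    : ∀ c d → colour c d ≡ colour d c
    colour-bound  : ∀ {c d} → c < p → d < p → c ≢ d → colour c d < K
    colour-proper : ∀ {c d e} → c < p → d < p → e < p → c ≢ d → c ≢ e → d ≢ e →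
                    colour c d ≢ colour c e

AllColoursUsed : ∀ {p K} → EdgeColouring p K → Set
AllColoursUsed {p} {K} χ = ∀ {y} → y < K → ∃₂ λ c d → c < p × d < p × c ≢ d × colour c d ≡ y
  where open EdgeColouring χ

module TriangleHypergraph {m K : ℕ} (χ : EdgeColouring (2 + m) K) (onto : AllColoursUsed χ) where
  open EdgeColouring χ

  -- Vertices 0, …, p − 1 form the core, p, …, p + K − 1 are the extra vertices.
  p n : ℕ
  p = 2 + m
  n = p + K

  isCore : ℕ → Bool
  isCore x = x <ᵇ p

  core<n : ∀ {x} → x < p → x < n
  core<n x<p = <-≤-trans x<p (m≤m+n p K)

  apex<n : ∀ {c d} → c < p → d < p → c ≢ d → p + colour c d < n
  apex<n c<p d<p c≢d = +-monoʳ-< p (colour-bound c<p d<p c≢d)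

  core≢apex : ∀ {x} y → x < p → x ≢ p + y
  core≢apex y x<p = <⇒≢ (<-≤-trans x<p (m≤m+n p y))

  inTriangle : ℕ → ℕ → ℕ → Bool
  inTriangle c d x = (x ≡ᵇ c) ∨ ((x ≡ᵇ d) ∨ (x ≡ᵇ p + colour c d))

  Tri : ℕ → ℕ → Subset n
  Tri c d = fromPred (inTriangle c d)

  member-Tri⁻ : ∀ {c d x} → x < n → member (Tri c d) x ≡ true →
                x ≡ c ⊎ x ≡ d ⊎ x ≡ p + colour c d
  member-Tri⁻ {c} {d} x<n x∈T with ∨-true (trans (sym (member-fromPred (inTriangle c d) x<n)) x∈T)
  ... | inj₁ e = inj₁ (≡ᵇ-sound e)
  ... | inj₂ e with ∨-true e
  ...   | inj₁ e′ = inj₂ (inj₁ (≡ᵇ-sound e′))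
  ...   | inj₂ e′ = inj₂ (inj₂ (≡ᵇ-sound e′))

  member-Tri⁺ : ∀ c d {x} → x < n → x ≡ c ⊎ x ≡ d ⊎ x ≡ p + colour c d →
                member (Tri c d) x ≡ true
  member-Tri⁺ c d {x} x<n cases = trans (member-fromPred (inTriangle c d) x<n) (holds cases)
    where
    holds : x ≡ c ⊎ x ≡ d ⊎ x ≡ p + colour c d → inTriangle c d x ≡ true
    holds (inj₁ refl)        = ∨-introˡ _ (≡ᵇ-true {x} refl)
    holds (inj₂ (inj₁ refl)) = ∨-introʳ (x ≡ᵇ c) (∨-introˡ _ (≡ᵇ-true {x} refl))
    holds (inj₂ (inj₂ refl)) = ∨-introʳ (x ≡ᵇ c) (∨-introʳ (x ≡ᵇ d) (≡ᵇ-true {x} refl))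

  ∣Tri∣ : ∀ {c d} → c < p → d < p → c ≢ d → ∣ Tri c d ∣ ≡ 3
  ∣Tri∣ {c} {d} c<p d<p c≢d = begin
      ∣ Tri c d ∣                  ≡⟨ ∣∣≡count (Tri c d) ⟩
      count n (member (Tri c d))   ≡⟨ count-cong n (λ x x<n → member-fromPred (inTriangle c d) x<n) ⟩
      count n (inTriangle c d)     ≡⟨ count-three (core<n c<p) (core<n d<p) (apex<n c<p d<p c≢d) c≢d
                                        (core≢apex _ c<p) (core≢apex _ d<p) ⟩
      3                            ∎
    where open ≡-Reasoning

  Tri-sym : ∀ c d → Tri c d ≡ Tri d c
  Tri-sym c d = member-ext (Tri c d) (Tri d c) λ x x<n → begin
      member (Tri c d) x  ≡⟨ member-fromPred (inTriangle c d) x<n ⟩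
      inTriangle c d x    ≡⟨ swap (x ≡ᵇ c) (x ≡ᵇ d) _ ⟩
      (x ≡ᵇ d) ∨ ((x ≡ᵇ c) ∨ (x ≡ᵇ p + colour c d))
                          ≡⟨ cong (λ y → (x ≡ᵇ d) ∨ ((x ≡ᵇ c) ∨ (x ≡ᵇ p + y))) (colour-sym c d) ⟩
      inTriangle d c x    ≡⟨ member-fromPred (inTriangle d c) x<n ⟨
      member (Tri d c) x  ∎
    where
    open ≡-Reasoning
    swap : ∀ a b e → a ∨ (b ∨ e) ≡ b ∨ (a ∨ e)
    swap false b     e = refl
    swap true  false e = refl
    swap true  true  e = refl

  IsTriangle : Subset n → Set
  IsTriangle S = ∃ λ d → d < p × ∃ λ c → c < d × S ≡ Tri c d

  triangle? : (S : Subset n) → Dec (IsTriangle S)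
  triangle? S = anyUpTo? (λ d → anyUpTo? (λ c → ≡-dec _≟ᵇ_ S (Tri c d)) d) p

  H : Hypergraph 3 n
  H = record { mark = λ S → not (does (triangle? S)) }

  nonEdge⇒triangle : ∀ S → mark H S ≡ false → IsTriangle S
  nonEdge⇒triangle S S∉H with triangle? S
  ... | yes isTri = isTri

  triangle-nonEdge : ∀ {c d} → c < p → d < p → c ≢ d → mark H (Tri c d) ≡ false
  triangle-nonEdge {c} {d} c<p d<p c≢d with <-cmp c d
  ... | tri< c<d _ _ = cong not (dec-true (triangle? (Tri c d)) (d , d<p , c , c<d , refl))
  ... | tri≈ _ c≡d _ = contradiction c≡d c≢d
  ... | tri> _ _ d<c = cong not (dec-true (triangle? (Tri c d)) (c , c<p , d , d<c , Tri-sym c d))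

  Tri⊆ : ∀ (R : Subset n) {c d} → member R c ≡ true → member R d ≡ true →
         member R (p + colour c d) ≡ true → Tri c d ⊆ R
  Tri⊆ R {c} {d} Rc Rd Rapex = member⇒⊆ λ x x<n x∈T → inR (member-Tri⁻ x<n x∈T)
    where
    inR : ∀ {x} → x ≡ c ⊎ x ≡ d ⊎ x ≡ p + colour c d → member R x ≡ true
    inR (inj₁ refl)        = Rc
    inR (inj₂ (inj₁ refl)) = Rd
    inR (inj₂ (inj₂ refl)) = Rapex

  colour-injective : ∀ {c x y} → c < p → x < p → y < p → c ≢ x → c ≢ y →
                     colour c x ≡ colour c y → x ≡ y
  colour-injective {c} {x} {y} c<p x<p y<p c≢x c≢y same with x ≟ y
  ... | yes x≡y = x≡y
  ... | no  x≢y = contradiction same (colour-proper c<p x<p y<p c≢x c≢y x≢y)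

  core-outside : ∀ (M : ℕ → Bool) → count n M ≤ m → ∃ λ c → c < p × M c ≡ false
  core-outside M |M|≤m with anyUpTo? (λ c → M c ≟ᵇ false) p
  ... | yes found = found
  ... | no  none  = contradiction (≤-trans p≤|M| |M|≤m) (<⇒≱ (m<n+m m z<s))
    where
    p≤|M| : p ≤ count n M
    p≤|M| = subst (_≤ count n M) (count-below (m≤m+n p K))
              (count-mono n λ x _ x-core → ¬-not λ Mx → none (x , <ᵇ-sound x-core , Mx))

  -- As d ↦ p + colour c d is injective, the extra vertices of M are
  -- at least as many as the p − 1 − |M ∩ core| core vertices outside M ∪ {c}; so |M| > m.
  crowded : ∀ (M : ℕ → Bool) {c} → c < p → M c ≡ false →
            (∀ {d} → d < p → c ≢ d → M d ≡ false → M (p + colour c d) ≡ true) → m < count n M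
  crowded M {c} c<p Mc apex-in-M = s≤s⁻¹ (begin
    p                          ≡⟨ core-count ⟩
    X + suc (count n outside)  ≤⟨ +-monoʳ-≤ X (s≤s outside≤extra) ⟩
    X + suc (count n extra)    ≡⟨ +-suc X (count n extra) ⟩
    suc (X + count n extra)    ≡⟨ cong suc extra-count ⟩
    suc (count n M)            ∎)
    where
    open ≤-Reasoning
    outside extra : ℕ → Bool
    outside x = (isCore x ∧ not (M x)) ∧ not (x ≡ᵇ c)
    extra x   = M x ∧ not (isCore x)
    X : ℕ
    X = count n (λ x → isCore x ∧ M x)

    outside-sound : ∀ {x} → outside x ≡ true → x < p × M x ≡ false × c ≢ x
    outside-sound {x} o with ∧-true o
    ... | core∧out , x≢c with ∧-true core∧out
    ...   | core , out = <ᵇ-sound core , not-true out , λ c≡x → ≡ᵇ-false-sound (not-true x≢c) (sym c≡x)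

    outside≤extra : count n outside ≤ count n extra
    outside≤extra = count-injection n n {outside} {extra} (λ x → p + colour c x) maps injective
      where
      maps : ∀ x → x < n → outside x ≡ true → p + colour c x < n × extra (p + colour c x) ≡ true
      maps x _ o with outside-sound o
      ... | x<p , Mx , c≢x = apex<n c<p x<p c≢x ,
        cong₂ (λ inM core → inM ∧ not core) (apex-in-M x<p c≢x Mx) (<ᵇ-false (m≤m+n p (colour c x)))
      injective : ∀ x y → x < n → y < n → outside x ≡ true → outside y ≡ true →
                  p + colour c x ≡ p + colour c y → x ≡ y
      injective x y _ _ ox oy same with outside-sound ox | outside-sound oy
      ... | x<p , _ , c≢x | y<p , _ , c≢y = colour-injective c<p x<p y<p c≢x c≢y (+-cancelˡ-≡ p _ _ same)

    core-count : p ≡ X + suc (count n outside)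
    core-count = begin-equality
      p                                         ≡⟨ count-below (m≤m+n p K) ⟨
      count n isCore                            ≡⟨ count-split n isCore M ⟩
      X + count n (λ x → isCore x ∧ not (M x))  ≡⟨ cong (X +_) (count-remove (λ x → isCore x ∧ not (M x))
                                                                   (core<n c<p) c-outside) ⟩
      X + suc (count n outside)                 ∎
      where
      c-outside : (isCore c ∧ not (M c)) ≡ true
      c-outside rewrite <ᵇ-true c<p | Mc = refl

    extra-count : X + count n extra ≡ count n M
    extra-count = begin-equality
      X + count n extra                               ≡⟨ cong (_+ count n extra)
                                                           (count-cong n λ x _ → ∧-comm (isCore x) (M x)) ⟩
      count n (λ x → M x ∧ isCore x) + count n extra  ≡⟨ count-split n M isCore ⟨
      count n M                                       ∎

  triangle-escapes : ∀ (M : ℕ → Bool) → count n M ≤ m → ∀ {c} → c < p → M c ≡ false →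
    ∃ λ d → d < p × d ≢ c × M d ≡ false × M (p + colour c d) ≡ false
  triangle-escapes M |M|≤m {c} c<p Mc
    with anyUpTo? (λ d → ¬? (d ≟ c) ×-dec (M d ≟ᵇ false) ×-dec (M (p + colour c d) ≟ᵇ false)) p
  ... | yes found = found
  ... | no  none  = contradiction |M|≤m (<⇒≱ (crowded M c<p Mc apex-in-M))
    where
    apex-in-M : ∀ {d} → d < p → c ≢ d → M d ≡ false → M (p + colour c d) ≡ true
    apex-in-M d<p c≢d Md = ¬-not λ Mapex → none (_ , d<p , (λ d≡c → c≢d (sym d≡c)) , Md , Mapex)

  not-edge : ∀ {c d} → c < p → d < p → c ≢ d → ¬ IsEdge H (Tri c d)
  not-edge c<p d<p c≢d (_ , T∈H) with trans (sym T∈H) (triangle-nonEdge c<p d<p c≢d)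
  ... | ()

  size+outside : ∀ (R : Subset n) → ∣ R ∣ + count n (not ∘ member R) ≡ (2 + K) + m
  size+outside R = begin
    ∣ R ∣ + count n (not ∘ member R)              ≡⟨ cong (_+ count n (not ∘ member R)) (∣∣≡count R) ⟩
    count n (member R) + count n (not ∘ member R) ≡⟨ count-complement n (member R) ⟩
    (2 + m) + K                                   ≡⟨ cong (2 +_) (+-comm m K) ⟩
    (2 + K) + m                                   ∎
    where open ≡-Reasoning

  outside-count : ∀ (R : Subset n) → ∣ R ∣ ≡ 2 + K → count n (not ∘ member R) ≡ m
  outside-count R |R| =
    +-cancelˡ-≡ (2 + K) _ _ (trans (cong (_+ count n (not ∘ member R)) (sym |R|)) (size+outside R))

  size-from-outside : ∀ (R : Subset n) → count n (not ∘ member R) ≡ m → ∣ R ∣ ≡ 2 + K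
  size-from-outside R out = +-cancelʳ-≡ m _ _ (trans (cong (∣ R ∣ +_) (sym out)) (size+outside R))

  core-inside : ∀ (R : Subset n) → ∣ R ∣ ≡ 2 + K → ∃ λ c → c < p × member R c ≡ true
  core-inside R |R| with core-outside (not ∘ member R) (≤-reflexive (outside-count R |R|))
  ... | c , c<p , Rc = c , c<p , not-false Rc

  triangle-inside : ∀ (R : Subset n) → ∣ R ∣ ≡ 2 + K → ∀ {c} → c < p → member R c ≡ true →
                    ∃ λ d → d < p × c ≢ d × Tri c d ⊆ R
  triangle-inside R |R| c<p Rc
    with triangle-escapes (not ∘ member R) (≤-reflexive (outside-count R |R|)) c<p (cong not Rc)
  ... | d , d<p , d≢c , Rd , Rapex =
    d , d<p , (λ c≡d → d≢c (sym c≡d)) , Tri⊆ R Rc (not-false Rd) (not-false Rapex)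

  -- H contains no K^(3)_(K+2): such a clique would contain a triangle, a non-edge.
  K-free : KFree (2 + K) H
  K-free R (|R| , clique) with core-inside R |R|
  ... | c , c<p , Rc with triangle-inside R |R| c<p Rc
  ... | d , d<p , c≢d , T⊆R = not-edge c<p d<p c≢d (clique (Tri c d) T⊆R (∣Tri∣ c<p d<p c≢d))

  -- Adding the triangle Tri a b (a < b < p) creates the clique R of all vertices except
  -- the m core vertices other than a and b, and no other clique.
  module AddTriangle {a b} (a<b : a < b) (b<p : b < p) where
    spared : ℕ → Bool
    spared x = (isCore x ∧ not (x ≡ᵇ a)) ∧ not (x ≡ᵇ b)

    R : Subset n
    R = fromPred (not ∘ spared)

    spared-sound : ∀ {x} → spared x ≡ true → x < p × x ≢ a × x ≢ b
    spared-sound s with ∧-true s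
    ... | core∧x≢a , x≢b with ∧-true core∧x≢a
    ...   | core , x≢a = <ᵇ-sound core , ≡ᵇ-false-sound (not-true x≢a) , ≡ᵇ-false-sound (not-true x≢b)

    unspared-core : ∀ {x} → x < p → spared x ≡ false → x ≡ a ⊎ x ≡ b
    unspared-core {x} x<p s rewrite <ᵇ-true x<p with x ≡ᵇ a in x≡a | x ≡ᵇ b in x≡b
    ... | true  | _    = inj₁ (≡ᵇ-sound x≡a)
    ... | false | true = inj₂ (≡ᵇ-sound x≡b)

    spared-count : count n spared ≡ m
    spared-count = suc-injective (suc-injective (begin
      2 + count n spared                 ≡⟨ cong suc (count-remove core-but-a (core<n b<p) b-left) ⟨
      1 + count n core-but-a             ≡⟨ count-remove isCore (core<n a<p) (<ᵇ-true a<p) ⟨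
      count n isCore                     ≡⟨ count-below (m≤m+n p K) ⟩
      2 + m                              ∎))
      where
      open ≡-Reasoning
      a<p : a < p
      a<p = <-trans a<b b<p
      core-but-a : ℕ → Bool
      core-but-a x = isCore x ∧ not (x ≡ᵇ a)
      b-left : (isCore b ∧ not (b ≡ᵇ a)) ≡ true
      b-left rewrite <ᵇ-true b<p | ≡ᵇ-false (λ b≡a → <⇒≢ a<b (sym b≡a)) = refl

    member-R : ∀ {x} → x < n → member R x ≡ not (spared x)
    member-R = member-fromPred (not ∘ spared)

    R-clique : IsCliqueOf 3 (2 + K) (PlusEdge H (Tri a b)) R
    R-clique = size-from-outside R outside-R , is-edge
      where
      outside-R : count n (not ∘ member R) ≡ m
      outside-R = trans (count-cong n λ x x<n → trans (cong not (member-R x<n)) (not-involutive (spared x)))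
                        spared-count
      core-in-R : ∀ {T x} → T ⊆ R → x < p → member T x ≡ true → x ≡ a ⊎ x ≡ b
      core-in-R {T} T⊆R x<p Tx =
        unspared-core x<p (not-true (trans (sym (member-R (core<n x<p))) (⊆⇒member T⊆R _ (core<n x<p) Tx)))
      same-pair : ∀ {c d} → c < d → c ≡ a ⊎ c ≡ b → d ≡ a ⊎ d ≡ b → c ≡ a × d ≡ b
      same-pair c<d (inj₁ c≡a)  (inj₂ d≡b)  = c≡a , d≡b
      same-pair c<d (inj₁ refl) (inj₁ refl) = contradiction c<d (<-irrefl refl)
      same-pair c<d (inj₂ refl) (inj₂ refl) = contradiction c<d (<-irrefl refl)
      same-pair c<d (inj₂ refl) (inj₁ refl) = contradiction c<d (<-asym a<b)
      is-edge : ∀ T → T ⊆ R → ∣ T ∣ ≡ 3 → PlusEdge H (Tri a b) T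
      is-edge T T⊆R |T| with mark H T in T∈H
      ... | true  = inj₁ (|T| , refl)
      ... | false with nonEdge⇒triangle T T∈H
      ...   | d , d<p , c , c<d , refl
        with same-pair c<d (core-in-R T⊆R (<-trans c<d d<p)
                                      (member-Tri⁺ c d (core<n (<-trans c<d d<p)) (inj₁ refl)))
                           (core-in-R T⊆R d<p (member-Tri⁺ c d (core<n d<p) (inj₂ (inj₁ refl))))
      ...   | refl , refl = inj₂ refl

    -- A clique R′ of H + Tri a b contains no spared vertex: it would give a triangle inside R′
    -- other than Tri a b.  As R′ leaves out m vertices too, it leaves out exactly the spared ones.
    R-unique : ∀ R′ → IsCliqueOf 3 (2 + K) (PlusEdge H (Tri a b)) R′ → R′ ≡ R
    R-unique R′ (|R′| , clique′) = member-ext R′ R λ x x<n → trans (agrees x<n) (sym (member-R x<n))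
      where
      spared-outside : ∀ x → x < n → spared x ≡ true → not (member R′ x) ≡ true
      spared-outside x x<n s with member R′ x in R′x | spared-sound s
      ... | false | _ = refl
      ... | true  | x<p , x≢a , x≢b with triangle-inside R′ |R′| x<p R′x
      ...   | d , d<p , x≢d , T⊆R′ with clique′ (Tri x d) T⊆R′ (∣Tri∣ x<p d<p x≢d)
      ...     | inj₁ T∈H = contradiction T∈H (not-edge x<p d<p x≢d)
      ...     | inj₂ T≡S
        with member-Tri⁻ x<n (subst (λ T → member T x ≡ true) T≡S (member-Tri⁺ x d x<n (inj₁ refl)))
      ...       | inj₁ x≡a        = contradiction x≡a x≢a
      ...       | inj₂ (inj₁ x≡b) = contradiction x≡b x≢b
      ...       | inj₂ (inj₂ x≡apex) = contradiction x≡apex (core≢apex _ x<p)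
      outside⊆spared : ∀ x → x < n → not (member R′ x) ≡ true → spared x ≡ true
      outside⊆spared = count-equal-subset n spared-outside
                         (≤-reflexive (trans (outside-count R′ |R′|) (sym spared-count)))
      agrees : ∀ {x} → x < n → member R′ x ≡ not (spared x)
      agrees {x} x<n with member R′ x in R′x | spared x in s
      ... | true  | false = refl
      ... | false | true  = refl
      ... | true  | true  = contradiction (trans (sym (cong not R′x)) (spared-outside x x<n s)) λ ()
      ... | false | false = contradiction (trans (sym s) (outside⊆spared x x<n (cong not R′x))) λ ()

  saturated : ∀ S → IsNonEdge H S → ExactlyOneClique 3 (2 + K) (PlusEdge H S)
  saturated S (_ , S∉H) with nonEdge⇒triangle S S∉H
  ... | b , b<p , a , a<b , refl = R , R-clique , R-unique
    where open AddTriangle a<b b<p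

  -- Every vertex lies on a triangle: a core vertex together with any other core vertex, and
  -- the extra vertex p + y on an edge of colour y.
  vertex-in-triangle : ∀ {x} → x < n → ∃₂ λ c d → c < p × d < p × c ≢ d × member (Tri c d) x ≡ true
  vertex-in-triangle {x} x<n with x <? p
  ... | yes x<p = other x<p
    where
    other : ∀ {x} → x < p → ∃₂ λ c d → c < p × d < p × c ≢ d × member (Tri c d) x ≡ true
    other {zero}  x<p = 0 , 1 , x<p , s<s z<s , (λ ()) , member-Tri⁺ 0 1 (core<n x<p) (inj₁ refl)
    other {suc x} x<p = suc x , 0 , x<p , z<s , (λ ()) , member-Tri⁺ (suc x) 0 (core<n x<p) (inj₁ refl)
  ... | no  x≮p with onto (+-cancelˡ-< p _ _ (subst (_< n) (sym (m+[n∸m]≡n (≮⇒≥ x≮p))) x<n))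
  ...   | c , d , c<p , d<p , c≢d , colour≡ =
    c , d , c<p , d<p , c≢d , member-Tri⁺ c d x<n (inj₂ (inj₂ (begin
      x                ≡⟨ m+[n∸m]≡n (≮⇒≥ x≮p) ⟨
      p + (x ∸ p)      ≡⟨ cong (p +_) colour≡ ⟨
      p + colour c d   ∎)))
    where open ≡-Reasoning

  no-dominating : ∀ v → ¬ Dominating H v
  no-dominating v dominating with vertex-in-triangle (toℕ<n v)
  ... | c , d , c<p , d<p , c≢d , v∈T =
    not-edge c<p d<p c≢d (dominating (Tri c d) (∣Tri∣ c<p d<p c≢d) (member⇒∈ (Tri c d) v v∈T))

  H-primitive : PrimitiveUniquelySaturated (2 + K) H
  H-primitive = (K-free , saturated) , no-dominating

pairs : ℕ → ℕ
pairs zero    = 0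
pairs (suc d) = pairs d + d

pairs-mono : ∀ {d d′} → d ≤ d′ → pairs d ≤ pairs d′
pairs-mono z≤n = z≤n
pairs-mono {suc d} {suc d′} (s≤s d≤d′) = +-mono-≤ (pairs-mono d≤d′) d≤d′

pairs-offset-< : ∀ {d d′ x x′} → x < d → d < d′ → pairs d + x < pairs d′ + x′
pairs-offset-< {d} {d′} {x} {x′} x<d d<d′ =
  <-≤-trans (+-monoʳ-< (pairs d) x<d) (≤-trans (pairs-mono d<d′) (m≤m+n (pairs d′) x′))

pairs-offset-injective : ∀ {d d′ x x′} → x < d → x′ < d′ → pairs d + x ≡ pairs d′ + x′ →
                         d ≡ d′ × x ≡ x′
pairs-offset-injective {d} {d′} {x} {x′} x<d x′<d′ same with <-cmp d d′
... | tri≈ _ refl _ = refl , +-cancelˡ-≡ (pairs d) x x′ same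
... | tri< d<d′ _ _ = contradiction same (<⇒≢ (pairs-offset-< x<d d<d′))
... | tri> _ _ d′<d = contradiction (sym same) (<⇒≢ (pairs-offset-< x′<d′ d′<d))

pairs-offset-onto : ∀ p {j} → j < pairs p → ∃₂ λ x d → x < d × d < p × pairs d + x ≡ j
pairs-offset-onto (suc p) {j} j<pairs with j <? pairs p
... | yes j<pairs-p with pairs-offset-onto p j<pairs-p
...   | x , d , x<d , d<p , eq = x , d , x<d , m<n⇒m<1+n d<p , eq
pairs-offset-onto (suc p) {j} j<pairs | no j≮pairs-p =
  j ∸ pairs p , p ,
  +-cancelˡ-< (pairs p) _ _ (subst (_< pairs p + p) (sym (m+[n∸m]≡n pairs-p≤j)) j<pairs) ,
  n<1+n p , m+[n∸m]≡n pairs-p≤j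
  where pairs-p≤j = ≮⇒≥ j≮pairs-p

∸-suc-< : ∀ {c d} → c < d → d ∸ suc c < d
∸-suc-< {c} {suc d} _ = s≤s (m∸n≤m d c)

∸-suc-involutive : ∀ {x d} → x < d → d ∸ suc (d ∸ suc x) ≡ x
∸-suc-involutive {x} {suc d} x<1+d = m∸[m∸n]≡n (s≤s⁻¹ x<1+d)

-- The position of the pair c < d when pairs are listed row by row (d = 1, 2, …), each
-- row d from c = d − 1 down to c = 0.  The last p − 1 positions below pairs p are then
-- the pairs (c, p − 1), and the one before them is (0, p − 2).
pairIndex : ℕ → ℕ → ℕ
pairIndex c d = pairs d + (d ∸ suc c)

pairIndex-injective : ∀ {c d c′ d′} → c < d → c′ < d′ → pairIndex c d ≡ pairIndex c′ d′ →
                      c ≡ c′ × d ≡ d′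
pairIndex-injective c<d c′<d′ same with pairs-offset-injective (∸-suc-< c<d) (∸-suc-< c′<d′) same
... | refl , offset≡ = suc-injective (∸-cancelˡ-≡ c<d c′<d′ offset≡) , refl

pairIndex-onto : ∀ p {j} → j < pairs p → ∃₂ λ c d → c < d × d < p × pairIndex c d ≡ j
pairIndex-onto p j<pairs with pairs-offset-onto p j<pairs
... | x , d , x<d , d<p , eq =
  d ∸ suc x , d , ∸-suc-< x<d , d<p , trans (cong (pairs d +_) (∸-suc-involutive x<d)) eq

edgeIndex : ℕ → ℕ → ℕ
edgeIndex c d = pairIndex (c ⊓ d) (c ⊔ d)

edgeIndex-sym : ∀ c d → edgeIndex c d ≡ edgeIndex d c
edgeIndex-sym c d = cong₂ pairIndex (⊓-comm c d) (⊔-comm c d)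

edgeIndex-ordered : ∀ {c d} → c < d → edgeIndex c d ≡ pairIndex c d
edgeIndex-ordered c<d = cong₂ pairIndex (m≤n⇒m⊓n≡m (<⇒≤ c<d)) (m≤n⇒m⊔n≡n (<⇒≤ c<d))

⊓<⊔ : ∀ {c d} → c ≢ d → c ⊓ d < c ⊔ d
⊓<⊔ {c} {d} c≢d with <-cmp c d
... | tri< c<d _ _ = subst₂ _<_ (sym (m≤n⇒m⊓n≡m (<⇒≤ c<d))) (sym (m≤n⇒m⊔n≡n (<⇒≤ c<d))) c<d
... | tri≈ _ c≡d _ = contradiction c≡d c≢d
... | tri> _ _ d<c = subst₂ _<_ (sym (m≥n⇒m⊓n≡n (<⇒≤ d<c))) (sym (m≥n⇒m⊔n≡m (<⇒≤ d<c))) d<c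

⊓+⊔ : ∀ c d → (c ⊓ d) + (c ⊔ d) ≡ c + d
⊓+⊔ c d with ≤-total c d
... | inj₁ c≤d = cong₂ _+_ (m≤n⇒m⊓n≡m c≤d) (m≤n⇒m⊔n≡n c≤d)
... | inj₂ d≤c = trans (cong₂ _+_ (m≥n⇒m⊓n≡n d≤c) (m≥n⇒m⊔n≡m d≤c)) (+-comm d c)

edgeIndex-injective : ∀ {c d e} → c ≢ d → c ≢ e → edgeIndex c d ≡ edgeIndex c e → d ≡ e
edgeIndex-injective {c} {d} {e} c≢d c≢e same with pairIndex-injective (⊓<⊔ c≢d) (⊓<⊔ c≢e) same
... | min≡ , max≡ = +-cancelˡ-≡ c d e (begin
  c + d              ≡⟨ ⊓+⊔ c d ⟨
  (c ⊓ d) + (c ⊔ d)      ≡⟨ cong₂ _+_ min≡ max≡ ⟩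
  (c ⊓ e) + (c ⊔ e)      ≡⟨ ⊓+⊔ c e ⟩
  c + e              ∎)
  where open ≡-Reasoning

TailRainbow : ∀ {p q} → EdgeColouring p q → Set
TailRainbow {p} {q} χ =
  ∀ {y} → y < q → ∃₂ λ c d → c < d × d < p × pairs p ∸ q ≤ pairIndex c d × colour c d ≡ y
  where open EdgeColouring χ

-- From q to K colours (q ≤ K ≤ pairs p): the first K − q pairs get the new colours
-- q, …, K − 1, one each, and all other pairs keep their colour.  Properness is kept, and
-- every old colour survives on one of the last q pairs, which are not recoloured.
module Recolouring {p q K} (χ : EdgeColouring p q) (rainbow : TailRainbow χ)
                   (q≤K : q ≤ K) (K≤pairs : K ≤ pairs p) where
  open EdgeColouring χ renaming (colour to old; colour-sym to old-sym;
                                 colour-bound to old-bound; colour-proper to old-proper)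

  F : ℕ
  F = K ∸ q

  new : ℕ → ℕ → ℕ
  new c d = if edgeIndex c d <ᵇ F then q + edgeIndex c d else old c d

  new-fresh : ∀ {c d} → edgeIndex c d < F → new c d ≡ q + edgeIndex c d
  new-fresh i<F rewrite <ᵇ-true i<F = refl

  new-old : ∀ {c d} → F ≤ edgeIndex c d → new c d ≡ old c d
  new-old F≤i rewrite <ᵇ-false F≤i = refl

  new-sym : ∀ c d → new c d ≡ new d c
  new-sym c d rewrite edgeIndex-sym c d | old-sym c d = refl

  new-bound : ∀ {c d} → c < p → d < p → c ≢ d → new c d < K
  new-bound {c} {d} c<p d<p c≢d with edgeIndex c d <? F
  ... | yes i<F = subst (_< K) (sym (new-fresh i<F))
                    (subst (q + edgeIndex c d <_) (m+[n∸m]≡n q≤K) (+-monoʳ-< q i<F))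
  ... | no  i≮F = subst (_< K) (sym (new-old (≮⇒≥ i≮F))) (<-≤-trans (old-bound c<p d<p c≢d) q≤K)

  fresh≢old : ∀ c d {c′ d′} → c′ < p → d′ < p → c′ ≢ d′ → q + edgeIndex c d ≢ old c′ d′
  fresh≢old c d c′<p d′<p c′≢d′ same =
    <⇒≱ (old-bound c′<p d′<p c′≢d′) (subst (q ≤_) same (m≤m+n q (edgeIndex c d)))

  new-proper : ∀ {c d e} → c < p → d < p → e < p → c ≢ d → c ≢ e → d ≢ e → new c d ≢ new c e
  new-proper {c} {d} {e} c<p d<p e<p c≢d c≢e d≢e same with edgeIndex c d <? F | edgeIndex c e <? F
  ... | yes cd<F | yes ce<F = d≢e (edgeIndex-injective c≢d c≢e
          (+-cancelˡ-≡ q _ _ (trans (sym (new-fresh cd<F)) (trans same (new-fresh ce<F)))))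
  ... | yes cd<F | no  ce≮F = fresh≢old c d c<p e<p c≢e
          (trans (sym (new-fresh cd<F)) (trans same (new-old (≮⇒≥ ce≮F))))
  ... | no  cd≮F | yes ce<F = fresh≢old c e c<p d<p c≢d
          (trans (sym (new-fresh ce<F)) (trans (sym same) (new-old (≮⇒≥ cd≮F))))
  ... | no  cd≮F | no  ce≮F = old-proper c<p d<p e<p c≢d c≢e d≢e
          (trans (sym (new-old (≮⇒≥ cd≮F))) (trans same (new-old (≮⇒≥ ce≮F))))

  -- an old colour survives on a pair of the tail, which is not recoloured
  old-colour-used : ∀ {y} → y < q → ∃₂ λ c d → c < p × d < p × c ≢ d × new c d ≡ y
  old-colour-used y<q with rainbow y<q
  ... | c , d , c<d , d<p , tail≤index , old≡y =
    c , d , <-trans c<d d<p , d<p , <⇒≢ c<d , trans (new-old F≤index) old≡y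
    where
    open ≤-Reasoning
    F≤index : F ≤ edgeIndex c d
    F≤index = begin
      F                ≤⟨ ∸-monoˡ-≤ q K≤pairs ⟩
      pairs p ∸ q      ≤⟨ tail≤index ⟩
      pairIndex c d    ≡⟨ edgeIndex-ordered c<d ⟨
      edgeIndex c d    ∎

  new-colour-used : ∀ {j} → j < F → ∃₂ λ c d → c < p × d < p × c ≢ d × new c d ≡ q + j
  new-colour-used {j} j<F with pairIndex-onto p (<-≤-trans j<F (≤-trans (m∸n≤m K q) K≤pairs))
  ... | c , d , c<d , d<p , index≡ =
    c , d , <-trans c<d d<p , d<p , <⇒≢ c<d ,
    trans (new-fresh (subst (_< F) (sym edge≡) j<F)) (cong (q +_) edge≡)
    where
    edge≡ : edgeIndex c d ≡ j
    edge≡ = trans (edgeIndex-ordered c<d) index≡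

  recoloured : EdgeColouring p K
  recoloured = record { colour = new ; colour-sym = new-sym ; colour-bound = new-bound ;
                        colour-proper = new-proper }

  recoloured-onto : AllColoursUsed recoloured
  recoloured-onto {y} y<K with y <? q
  ... | yes y<q = old-colour-used y<q
  ... | no  y≮q with new-colour-used (∸-monoˡ-< y<K (≮⇒≥ y≮q))
  ...   | c , d , c<p , d<p , c≢d , new≡ = c , d , c<p , d<p , c≢d , trans new≡ (m+[n∸m]≡n (≮⇒≥ y≮q))

recolour : ∀ {p q K} (χ : EdgeColouring p q) → TailRainbow χ → q ≤ K → K ≤ pairs p →
           Σ (EdgeColouring p K) AllColoursUsed
recolour χ rainbow q≤K K≤pairs = recoloured , recoloured-onto
  where open Recolouring χ rainbow q≤K K≤pairs

data EvenOdd : ℕ → Set where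
  even : ∀ k → EvenOdd (2 * k)
  odd  : ∀ k → EvenOdd (suc (2 * k))

even-or-odd : ∀ n → EvenOdd n
even-or-odd zero = even 0
even-or-odd (suc n) with even-or-odd n
... | even k = odd k
... | odd  k = subst EvenOdd (*-suc 2 k) (even (suc k))

-- Reduction modulo q of a number below 2q.
wrap : ℕ → ℕ → ℕ
wrap q x = if x <ᵇ q then x else x ∸ q

wrap-low : ∀ {q x} → x < q → wrap q x ≡ x
wrap-low x<q rewrite <ᵇ-true x<q = refl

wrap-high : ∀ {q x} → q ≤ x → wrap q x ≡ x ∸ q
wrap-high q≤x rewrite <ᵇ-false q≤x = refl

wrap-+q : ∀ q y → wrap q (y + q) ≡ y
wrap-+q q y = trans (wrap-high (m≤n+m q y)) (m+n∸n≡m y q)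

wrap-bound : ∀ {q x} → x < q + q → wrap q x < q
wrap-bound {q} {x} x<2q with x <? q
... | yes x<q = subst (_< q) (sym (wrap-low x<q)) x<q
... | no  x≮q = subst (_< q) (sym (wrap-high (≮⇒≥ x≮q)))
                  (+-cancelˡ-< q _ _ (subst (_< q + q) (sym (m+[n∸m]≡n (≮⇒≥ x≮q))) x<2q))

wrap-collision : ∀ {q x y} → wrap q x ≡ wrap q y → x ≡ y ⊎ x ≡ y + q ⊎ y ≡ x + q
wrap-collision {q} {x} {y} same with x <? q | y <? q
... | yes x<q | yes y<q = inj₁ (trans (sym (wrap-low x<q)) (trans same (wrap-low y<q)))
... | yes x<q | no  y≮q = inj₂ (inj₂ (trans (sym (m∸n+n≡m (≮⇒≥ y≮q)))
        (cong (_+ q) (trans (sym (wrap-high (≮⇒≥ y≮q))) (trans (sym same) (wrap-low x<q))))))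
... | no  x≮q | yes y<q = inj₂ (inj₁ (trans (sym (m∸n+n≡m (≮⇒≥ x≮q)))
        (cong (_+ q) (trans (sym (wrap-high (≮⇒≥ x≮q))) (trans same (wrap-low y<q))))))
... | no  x≮q | no  y≮q = inj₁ (trans (sym (m∸n+n≡m (≮⇒≥ x≮q)))
        (trans (cong (_+ q) (trans (sym (wrap-high (≮⇒≥ x≮q))) (trans same (wrap-high (≮⇒≥ y≮q)))))
               (m∸n+n≡m (≮⇒≥ y≮q))))

sum-shift : ∀ {q} c {d e} → c + d ≡ c + e + q → q ≤ d
sum-shift {q} c {d} {e} eq = subst (q ≤_) (sym (+-cancelˡ-≡ c _ _ (trans eq (+-assoc c e q)))) (m≤n+m q e)

sum-cancel : ∀ {q c d e} → d < q → e < q → wrap q (c + d) ≡ wrap q (c + e) → d ≡ e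
sum-cancel {q} {c} {d} {e} d<q e<q same with wrap-collision same
... | inj₁ eq        = +-cancelˡ-≡ c d e eq
... | inj₂ (inj₁ eq) = contradiction (sum-shift c eq) (<⇒≱ d<q)
... | inj₂ (inj₂ eq) = contradiction (sum-shift c eq) (<⇒≱ e<q)

last-row-tail : ∀ d {k} x → d ≤ k → pairs (suc d) ∸ k ≤ pairs d + x
last-row-tail d {k} x d≤k = begin
  (pairs d + d) ∸ k  ≤⟨ ∸-monoʳ-≤ (pairs d + d) d≤k ⟩
  (pairs d + d) ∸ d  ≡⟨ m+n∸n≡m (pairs d) d ⟩
  pairs d            ≤⟨ m≤m+n (pairs d) x ⟩
  pairs d + x        ∎
  where open ≤-Reasoning

-- Odd m: colour the edge cd of K_q by (c + d) mod q; this is proper for every q.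
sum-colouring : ∀ q → EdgeColouring q q
sum-colouring q = record
  { colour        = λ c d → wrap q (c + d)
  ; colour-sym    = λ c d → cong (wrap q) (+-comm c d)
  ; colour-bound  = λ c<q d<q _ → wrap-bound (+-mono-< c<q d<q)
  ; colour-proper = λ _ d<q e<q _ _ d≢e same → d≢e (sum-cancel d<q e<q same)
  }

-- For q = t + 3 the last row, the pairs (c, q − 1), shows every colour except q − 2, which
-- is shown by (0, q − 2), the pair just before it.
sum-rainbow : ∀ t → TailRainbow (sum-colouring (3 + t))
sum-rainbow t {y} y<q with <-cmp y (suc t)
... | tri< y<1+t _ _ = suc y , 2 + t , s≤s y<1+t , ≤-refl , last-row-tail (2 + t) _ (n≤1+n _) ,
                       trans (cong (wrap (3 + t)) (sym (+-suc y (2 + t)))) (wrap-+q (3 + t) y)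
... | tri≈ _ refl _  = 0 , 1 + t , z<s , n≤1+n _ , ≤-reflexive penultimate , wrap-low y<q
  where
  penultimate : pairs (3 + t) ∸ (3 + t) ≡ pairs (1 + t) + t
  penultimate = trans (cong (_∸ (3 + t)) (regroup (pairs (1 + t)) t)) (m+n∸n≡m (pairs (1 + t) + t) (3 + t))
    where
    regroup : ∀ P t → (P + suc t) + suc (suc t) ≡ (P + t) + (3 + t)
    regroup = solve-∀
... | tri> _ _ 1+t<y with ≤-antisym (s≤s⁻¹ y<q) 1+t<y
...   | refl = 0 , 2 + t , z<s , ≤-refl , last-row-tail (2 + t) _ (n≤1+n _) , wrap-low y<q

-- Even m: the standard colouring of K_{q+1} with q = 2s + 1 colours.  The extra vertex q
-- takes the place of the other endpoint, so the edge {c, q} gets colour 2c mod q.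
module Star (s : ℕ) where
  q : ℕ
  q = suc (2 * s)

  partner : ℕ → ℕ → ℕ
  partner c d = if c ≡ᵇ q then d else c

  partner-hub : ∀ d → partner q d ≡ d
  partner-hub d rewrite ≡ᵇ-true {q} refl = refl

  partner-other : ∀ {c} d → c ≢ q → partner c d ≡ c
  partner-other d c≢q rewrite ≡ᵇ-false c≢q = refl

  below-q : ∀ {c} → c < suc q → c ≢ q → c < q
  below-q c<1+q c≢q = ≤∧≢⇒< (s≤s⁻¹ c<1+q) c≢q

  partner-bound : ∀ {c d} → c < suc q → d < suc q → c ≢ d → partner c d < q
  partner-bound {c} {d} c<1+q d<1+q c≢d with c ≟ q
  ... | yes refl = subst (_< q) (sym (partner-hub d)) (below-q d<1+q (λ d≡q → c≢d (sym d≡q)))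
  ... | no  c≢q  = subst (_< q) (sym (partner-other d c≢q)) (below-q c<1+q c≢q)

  partner-injective : ∀ {c d e} → c ≢ d → c ≢ e → partner d c ≡ partner e c → d ≡ e
  partner-injective {c} {d} {e} c≢d c≢e same with d ≟ q | e ≟ q
  ... | yes d≡q | yes e≡q = trans d≡q (sym e≡q)
  ... | yes refl | no e≢q =
    contradiction (trans (sym (partner-hub c)) (trans same (partner-other c e≢q))) c≢e
  ... | no d≢q | yes refl =
    contradiction (trans (sym (partner-hub c)) (trans (sym same) (partner-other c d≢q))) c≢d
  ... | no d≢q | no e≢q   = trans (sym (partner-other c d≢q)) (trans same (partner-other c e≢q))

  double : ∀ x → x + x ≡ 2 * x
  double = solve-∀

  odd-sum : ∀ x → (x + x) + q ≡ suc (2 * (x + s))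
  odd-sum x = shape x s
    where
    shape : ∀ x s → (x + x) + suc (2 * s) ≡ suc (2 * (x + s))
    shape = solve-∀

  -- doubling is injective modulo the odd number q
  double-cancel : ∀ {d e} → d < q → e < q → wrap q (d + d) ≡ wrap q (e + e) → d ≡ e
  double-cancel {d} {e} _ _ same with wrap-collision same
  ... | inj₁ eq        = *-cancelˡ-≡ d e 2 (trans (sym (double d)) (trans eq (double e)))
  ... | inj₂ (inj₁ eq) = contradiction (trans (sym (double d)) (trans eq (odd-sum e))) (even≢odd d (e + s))
  ... | inj₂ (inj₂ eq) = contradiction (trans (sym (double e)) (trans eq (odd-sum d))) (even≢odd e (d + s))

  colour : ℕ → ℕ → ℕ
  colour c d = wrap q (partner c d + partner d c)

  colour-from-hub : ∀ {d} → d ≢ q → colour q d ≡ wrap q (d + d)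
  colour-from-hub {d} d≢q = cong (wrap q) (cong₂ _+_ (partner-hub d) (partner-other q d≢q))

  colour-to-hub : ∀ {c} → c ≢ q → colour c q ≡ wrap q (c + c)
  colour-to-hub {c} c≢q = cong (wrap q) (cong₂ _+_ (partner-other q c≢q) (partner-hub c))

  colour-off-hub : ∀ {c} d → c ≢ q → colour c d ≡ wrap q (c + partner d c)
  colour-off-hub {c} d c≢q = cong (wrap q) (cong (_+ partner d c) (partner-other d c≢q))

  -- At a vertex c ≠ q the colours are the residues of c + partner, which are distinct since
  -- the partner determines the other endpoint; at c = q they are the doubles 2d mod q.
  colour-proper : ∀ {c d e} → c < suc q → d < suc q → e < suc q → c ≢ d → c ≢ e → d ≢ e →
                  colour c d ≢ colour c e
  colour-proper {c} {d} {e} c<1+q d<1+q e<1+q c≢d c≢e d≢e same with c ≟ q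
  ... | yes refl = d≢e (double-cancel (below-q d<1+q (≢-sym c≢d)) (below-q e<1+q (≢-sym c≢e))
                     (trans (sym (colour-from-hub (≢-sym c≢d))) (trans same (colour-from-hub (≢-sym c≢e)))))
  ... | no  c≢q  = d≢e (partner-injective c≢d c≢e
                     (sum-cancel {c = c} (partner-bound d<1+q c<1+q (≢-sym c≢d))
                                         (partner-bound e<1+q c<1+q (≢-sym c≢e))
                        (trans (sym (colour-off-hub d c≢q)) (trans same (colour-off-hub e c≢q)))))

  star-colouring : EdgeColouring (suc q) q
  star-colouring = record
    { colour        = colour
    ; colour-sym    = λ c d → cong (wrap q) (+-comm (partner c d) (partner d c))
    ; colour-bound  = λ c<1+q d<1+q c≢d →
                        wrap-bound (+-mono-< (partner-bound c<1+q d<1+q c≢d)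
                                             (partner-bound d<1+q c<1+q (≢-sym c≢d)))
    ; colour-proper = colour-proper
    }

  -- The last row consists of the q edges {c, q}, with the colours 2c mod q: all colours.
  star-rainbow : TailRainbow star-colouring
  star-rainbow {y} y<q with even-or-odd y
  ... | even k = k , q , k<q , n<1+n q , last-row-tail q _ ≤-refl ,
                 trans (colour-to-hub (<⇒≢ k<q)) (trans (cong (wrap q) (double k)) (wrap-low y<q))
    where
    k<q : k < q
    k<q = ≤-<-trans (m≤m+n k _) y<q
  ... | odd k = suc (k + s) , q , c<q , n<1+n q , last-row-tail q _ ≤-refl ,
                trans (colour-to-hub (<⇒≢ c<q)) (trans (cong (wrap q) (twice k s)) (wrap-+q q y))
    where
    c<q : suc (k + s) < q
    c<q = s≤s (subst (k + s <_) (double s) (+-monoˡ-< s (*-cancelˡ-< 2 k s (s≤s⁻¹ y<q))))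
    twice : ∀ k s → suc (k + s) + suc (k + s) ≡ suc (2 * k) + suc (2 * s)
    twice = solve-∀

pairs≡C2 : ∀ d → d C 2 ≡ pairs d
pairs≡C2 zero    = refl
pairs≡C2 (suc d) = begin
  suc d C 2        ≡⟨ nCk+nC[k+1]≡[n+1]C[k+1] d 1 ⟨
  d C 1 + d C 2    ≡⟨ cong₂ _+_ (nC1≡n d) (pairs≡C2 d) ⟩
  d + pairs d      ≡⟨ +-comm d (pairs d) ⟩
  pairs d + d      ∎
  where open ≡-Reasoning

even-mod : ∀ k → (2 * k) % 2 ≡ 0
even-mod k = trans (cong (_% 2) (*-comm 2 k)) ([m+kn]%n≡m%n 0 k 2)

odd-mod : ∀ k → suc (2 * k) % 2 ≡ 1
odd-mod k = trans (cong (λ x → suc x % 2) (*-comm 2 k)) ([m+kn]%n≡m%n 1 k 2)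

-- For the paper's range of K there is a suitable colouring of the core K_{m+2}: the odd
-- and even base colourings need m + 2 and m + 1 colours respectively.
colouring-exists : ∀ m K → (m % 2 ≡ 1 → 2 + m ≤ K) → (m % 2 ≡ 0 → 1 + m ≤ K) → K ≤ pairs (2 + m) →
                   Σ (EdgeColouring (2 + m) K) AllColoursUsed
colouring-exists m K odd-bound even-bound K≤pairs with even-or-odd m
... | even k = recolour (Star.star-colouring k) (Star.star-rainbow k) (even-bound (even-mod k)) K≤pairs
... | odd  k = recolour (sum-colouring (3 + 2 * k)) (sum-rainbow (2 * k)) (odd-bound (odd-mod k)) K≤pairs

construction : ∀ m K → (m % 2 ≡ 1 → 2 + m ≤ K) → (m % 2 ≡ 0 → 1 + m ≤ K) → K ≤ pairs (2 + m) →
               ∃[ H ] PrimitiveUniquelySaturated {3} {(2 + m) + K} (2 + K) H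
construction m K odd-bound even-bound K≤pairs with colouring-exists m K odd-bound even-bound K≤pairs
... | χ , onto = H , H-primitive
  where open TriangleHypergraph χ onto

corollary2 : (r n : ℕ) → 3 < r → r < n →
    n ≤ ((n ∸ r) + 3) C 2 →
    ((n ∸ r) % 2 ≡ 1 → 2 * (n ∸ r) + 4 ≤ n) →
    ((n ∸ r) % 2 ≡ 0 → 2 * (n ∸ r) + 3 ≤ n) →
    ∃[ H ] PrimitiveUniquelySaturated {3} {n} r H
corollary2 r n 3<r r<n n≤C odd-bound even-bound =
  subst₂ (λ v s → ∃[ H ] PrimitiveUniquelySaturated {3} {v} s H) n≡ r≡
    (construction m K (excess (twice 2) ∘ odd-bound) (excess (twice 1) ∘ even-bound)
                      (+-cancelˡ-≤ (2 + m) _ _ (subst₂ _≤_ (sym n≡) C≡ n≤C)))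
  where
  m K : ℕ
  m = n ∸ r
  K = r ∸ 2
  r≡ : 2 + K ≡ r
  r≡ = m+[n∸m]≡n (≤-trans (s≤s (s≤s z≤n)) (<⇒≤ 3<r))
  n≡ : (2 + m) + K ≡ n
  n≡ = begin
    (2 + m) + K  ≡⟨ cong (_+ K) (+-comm 2 m) ⟩
    (m + 2) + K  ≡⟨ +-assoc m 2 K ⟩
    m + (2 + K)  ≡⟨ cong (m +_) r≡ ⟩
    m + r        ≡⟨ m∸n+n≡m (<⇒≤ r<n) ⟩
    n            ∎
    where open ≡-Reasoning
  -- the hypotheses, read relative to n = (2 + m) + K, are bounds on K
  twice : ∀ a → 2 * m + (2 + a) ≡ (2 + m) + (a + m)
  twice a = regroup a m
    where
    regroup : ∀ a m → 2 * m + (2 + a) ≡ (2 + m) + (a + m)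
    regroup = solve-∀
  excess : ∀ {a b} → a ≡ (2 + m) + b → a ≤ n → b ≤ K
  excess a≡ a≤n = +-cancelˡ-≤ (2 + m) _ _ (subst₂ _≤_ a≡ (sym n≡) a≤n)
  C≡ : (m + 3) C 2 ≡ (2 + m) + pairs (2 + m)
  C≡ = trans (pairs≡C2 (m + 3)) (trans (cong pairs (+-comm m 3)) (+-comm (pairs (2 + m)) (2 + m)))
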